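{- Let $N\ge 1$ be an integer, let $K=M(N)+1$, and let $T$ be the perfect binary search tree on the node set $\{0,1,\dots,2^{K}-2\}$, with root $2^{K-1}-1=2^{M(N)}-1$. Note that $N-1\le 2^K-2$, so $N-1$ is a node of $T$. Run Algorithm 1 on $N$. Call an entry $e\in\{p[j],\,l[j],\,r[j]\}$ for $j\in\{0,\dots,N-1\}$ an edge from $j$ pointing to a missing node if $e$ is not NULL and $e\ge N$, i.e. $e\notin\{0,\dots,N-1\}$. Then for every such edge, with the possible exception of the entry $r[N-1]$ (the down-right edge of the node $N-1$), both endpoints $j$ and $e$ lie on the ascending path in $T$ from the node $N-1$ to the root of $T$. Here the node $N-1$ itself is considered to lie on this path.
   Context: Bits of a nonnegative integer are indexed from $0$, where bit $0$ is the least significant bit. For a nonnegative integer $j$: - $L(j)$ denotes the index of the least significant zero bit of $j$. - $M(j)$ denotes the index of the most significant one bit of $j$ (for $j\ge1$). - $\&$ denotes bitwise AND. Perfect binary search tree on $\{0,\dots,2^K-2\}$: - The level of a node $j$ is $L(j)$; leaves have level $0$, and the root $2^{K-1}-1$ has level $K-1$. - A node $j$ with $L(j)\ge1$ has left child $j-2^{L(j)-1}$ and right child $j+2^{L(j)-1}$. - A non-root node $j$ has parent $j+2^{L(j)}$ if $(j\,\&\,2^{L(j)+1})=0$, and parent $j-2^{L(j)}$ otherwise. Algorithm 1 (given $N$). It constructs arrays $p,l,r$ indexed by $\{0,\dots,N-1\}$ as follows. For each $j\in\{0,\dots,N-1\}$: - Set $p[j]:=j+2^{L(j)}$ if $(j\,\&\,2^{L(j)+1})=0$,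 and $p[j]:=j-2^{L(j)}$ otherwise. - If $L(j)>0$, set $l[j]:=j-2^{L(j)-1}$ and $r[j]:=j+2^{L(j)-1}$. Otherwise set $l[j]:=r[j]:=\mathrm{NULL}$. Finally, set $t:=2^{M(N)}-1$ and $p[t]:=\mathrm{NULL}$. Interpretation of the arrays: - $p[j]$ is the up edge (parent) of $j$. - $l[j]$ is the down-left edge (left child) of $j$. - $r[j]$ is the down-right edge (right child) of $j$. -}

module Defs where

open import Data.Nat using (ℕ; zero; suc; _+_; _∸_; _^_; _≤_; _<_; _≡ᵇ_)
open import Data.Nat.DivMod using (_/_; _%_)
open import Data.Nat.Logarithm using (⌊log₂_⌋)
open import Data.Bool using (Bool; true; false; if_then_else_)
open import Data.Maybe using (Maybe; just; nothing)
open import Data.Product using (∃; _×_)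
open import Relation.Binary.PropositionalEquality using (_≡_)

-- bit k of j, i.e. floor(j / 2^k) mod 2; (j & 2^k) = 0  iff  bit j k ≡ 0
bit : ℕ → ℕ → ℕ
bit j zero    = j % 2
bit j (suc k) = bit (j / 2) k

-- least significant zero bit, with fuel (fuel j suffices: L j ≤ j)
Lf : ℕ → ℕ → ℕ
Lf zero    j = 0
Lf (suc f) j = if (j % 2 ≡ᵇ 0) then 0 else suc (Lf f (j / 2))

L : ℕ → ℕ
L j = Lf (suc j) j

M : ℕ → ℕ
M j = ⌊log₂ j ⌋

parent : ℕ → ℕ
parent j = if (bit j (suc (L j)) ≡ᵇ 0) then j + 2 ^ L j else j ∸ 2 ^ L j

iterate : ℕ → (ℕ → ℕ) → ℕ → ℕ
iterate zero    f x = x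
iterate (suc k) f x = f (iterate k f x)

pArr : ℕ → ℕ → Maybe ℕ
pArr N j = if (j ≡ᵇ (2 ^ M N ∸ 1)) then nothing else just (parent j)

lArr : ℕ → ℕ → Maybe ℕ
lArr N j with L j
... | zero  = nothing
... | suc k = just (j ∸ 2 ^ k)

rArr : ℕ → ℕ → Maybe ℕ
rArr N j with L j
... | zero  = nothing
... | suc k = just (j + 2 ^ k)

data Dir : Set where
  up left right : Dir

entry : Dir → ℕ → ℕ → Maybe ℕ
entry up    = pArr
entry left  = lArr
entry right = rArr

K : ℕ → ℕ
K N = suc (M N)

IsNode : ℕ → ℕ → Set
IsNode N x = x ≤ 2 ^ K N ∸ 2

-- x lies on the ascending path in T from N-1 to the root:
-- x is obtained from N-1 by repeatedly taking parents, and x is a node of T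
-- (beyond the root, parent leaves T and never returns).
OnPath : ℕ → ℕ → Set
OnPath N x = ∃ λ k → iterate k parent (N ∸ 1) ≡ x × IsNode N x

module Submission where

-- Every number is x = 2^h (2m+1) - 1 with h = L x, and the
-- tree is self-similar: x ↦ 2x+1 raises the level by one and commutes with
-- the parent map (parent (2x+1) = 2 parent(x) + 1), while a leaf 2y has the
-- odd parent 2y ± 1.  From this we prove, by induction on h, the subtree
-- window lemma: a node x of level h is an ancestor of every y with
-- |y - x| < 2^h.  Together with the arithmetic bounds "the window of a node
-- stays below 2^K" and "a parent step can reach 2^K - 1 only from the root",
-- this handles the theorem edge by edge: left edges and downward up-edges
-- point below j < N and are never missing; a missing upward edge
-- e = j + 2^{L j} or right edge e = j + 2^k (j < N-1) has j ≤ N-1 < e,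
-- so N-1 lies in the windows of both j and e, whence both are ancestors of
-- N-1, and both are nodes of the tree.

open import Data.Nat
  using (ℕ; zero; suc; _+_; _*_; _∸_; _^_; _≤_; _<_; _≡ᵇ_; z≤n; s≤s; s≤s⁻¹; _≤?_)
open import Data.Nat.Properties
open import Data.Nat.DivMod using (_/_; _%_; m*n%n≡0; [m+kn]%n≡m%n; m*n/n≡m; +-distrib-/)
open import Data.Nat.Logarithm using (⌊log₂[2^n]⌋≡n; ⌊log₂⌋-mono-≤)
open import Data.Bool using (true; false; T; if_then_else_)
open import Data.Maybe using (just)
open import Data.Maybe.Properties using (just-injective)
open import Data.Product using (∃; _×_; _,_)
open import Data.Sum using (_⊎_; inj₁; inj₂)
open import Data.Empty using (⊥-elim)
open import Relation.Binary.PropositionalEquality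
open import Relation.Nullary using (¬_; yes; no)

open import Defs

-- Every number is m * 2 or m * 2 + 1; the bit functions of the algorithm
-- peel off the last binary digit, so all proofs recurse along this view.
data Halves : ℕ → Set where
  even : ∀ m → Halves (m * 2)
  odd  : ∀ m → Halves (suc (m * 2))

halves : ∀ n → Halves n
halves zero = even 0
halves (suc n) with halves n
... | even m = odd m
... | odd m  = even (suc m)

even%2 : ∀ m → m * 2 % 2 ≡ 0
even%2 m = m*n%n≡0 m 2

odd%2 : ∀ m → suc (m * 2) % 2 ≡ 1
odd%2 m = [m+kn]%n≡m%n 1 m 2

even/2 : ∀ m → m * 2 / 2 ≡ m
even/2 m = m*n/n≡m m 2

odd/2 : ∀ m → suc (m * 2) / 2 ≡ m
odd/2 m = trans (+-distrib-/ 1 (m * 2) (subst (λ r → 1 + r < 2) (sym (even%2 m)) (s≤s (s≤s z≤n))))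
                (even/2 m)

even≢odd′ : ∀ a b → ¬ a * 2 ≡ suc (b * 2)
even≢odd′ a b eq = even≢odd a b (trans (*-comm 2 a) (trans eq (cong suc (*-comm b 2))))

even-plus-even : ∀ m a → m * 2 + 2 * a ≡ (m + a) * 2
even-plus-even m a = trans (cong (m * 2 +_) (*-comm 2 a)) (sym (*-distribʳ-+ 2 m a))

odd-plus-even : ∀ m a → suc (m * 2) + 2 * a ≡ suc ((m + a) * 2)
odd-plus-even m a = cong suc (even-plus-even m a)

odd-minus-even : ∀ m a → a ≤ m → suc (m * 2) ∸ 2 * a ≡ suc ((m ∸ a) * 2)
odd-minus-even m a a≤m = begin
  suc (m * 2) ∸ 2 * a   ≡⟨ cong (suc (m * 2) ∸_) (*-comm 2 a) ⟩
  suc (m * 2) ∸ a * 2   ≡⟨ +-∸-assoc 1 (*-monoˡ-≤ 2 a≤m) ⟩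
  suc (m * 2 ∸ a * 2)   ≡⟨ cong suc (sym (*-distribʳ-∸ 2 m a)) ⟩
  suc ((m ∸ a) * 2)     ∎
  where open ≡-Reasoning

Lf-fuel : ∀ f g m → m < f → m < g → Lf f m ≡ Lf g m
Lf-fuel (suc f) (suc g) m m<f m<g with halves m
... | even k rewrite even%2 k = refl
... | odd k rewrite odd%2 k | odd/2 k =
  cong suc (Lf-fuel f g k (half< m<f) (half< m<g))
  where
  half< : ∀ {f} → suc (k * 2) < suc f → k < f
  half< p = ≤-trans (s≤s (m≤m*n k 2)) (s≤s⁻¹ p)

L-even : ∀ m → L (m * 2) ≡ 0
L-even m rewrite even%2 m = refl

L-odd : ∀ m → L (suc (m * 2)) ≡ suc (L m)
L-odd m rewrite odd%2 m | odd/2 m =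
  cong suc (Lf-fuel (suc (m * 2)) (suc m) m (s≤s (m≤m*n m 2)) ≤-refl)

L-zero⇒even : ∀ x → L x ≡ 0 → ∃ λ q → x ≡ q * 2
L-zero⇒even x Lx with halves x
... | even q = q , refl
... | odd q rewrite L-odd q with Lx
... | ()

L-suc⇒odd : ∀ x h → L x ≡ suc h → ∃ λ x′ → x ≡ suc (x′ * 2) × L x′ ≡ h
L-suc⇒odd x h Lx with halves x
... | even q rewrite L-even q with Lx
... | ()
L-suc⇒odd x h Lx | odd q rewrite L-odd q = q , refl , suc-injective Lx

bit-even : ∀ m k → bit (m * 2) (suc k) ≡ bit m k
bit-even m k rewrite even/2 m = refl

bit-odd : ∀ m k → bit (suc (m * 2)) (suc k) ≡ bit m k
bit-odd m k rewrite odd/2 m = refl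

-- A set bit k certifies m ≥ 2^k; this keeps downward parent steps in ℕ.
bit-set⇒≥ : ∀ m k → ¬ bit m k ≡ 0 → 2 ^ k ≤ m
bit-set⇒≥ m zero unset with halves m
... | even q rewrite even%2 q = ⊥-elim (unset refl)
... | odd q = s≤s z≤n
bit-set⇒≥ m (suc k) unset with halves m
... | even q rewrite bit-even q k =
  subst (_≤ q * 2) (*-comm (2 ^ k) 2) (*-monoˡ-≤ 2 (bit-set⇒≥ q k unset))
... | odd q rewrite bit-odd q k =
  m≤n⇒m≤1+n (subst (_≤ q * 2) (*-comm (2 ^ k) 2) (*-monoˡ-≤ 2 (bit-set⇒≥ q k unset)))

parent-up-or-down : ∀ j → parent j ≡ j + 2 ^ L j ⊎ parent j ≡ j ∸ 2 ^ L j
parent-up-or-down j with bit j (suc (L j)) ≡ᵇ 0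
... | true  = inj₁ refl
... | false = inj₂ refl

parent-odd : ∀ m → parent (suc (m * 2)) ≡ suc (parent m * 2)
parent-odd m rewrite L-odd m | bit-odd m (suc (L m)) with bit m (suc (L m)) ≡ᵇ 0 in goes-up
... | true  = odd-plus-even m (2 ^ L m)
... | false = odd-minus-even m (2 ^ L m)
  (≤-trans (m≤m+n (2 ^ L m) (2 ^ L m + 0))
           (bit-set⇒≥ m (suc (L m)) (λ bit≡0 → subst T goes-up (≡⇒≡ᵇ _ 0 bit≡0))))

parent-even : ∀ y → parent (y * 2) ≡ (if (y % 2 ≡ᵇ 0) then y * 2 + 1 else y * 2 ∸ 1)
parent-even y rewrite L-even y | bit-even y 0 = refl

parent-leaf : ∀ y → ∃ λ z → (y ≡ z * 2 ⊎ y ≡ suc (z * 2)) × parent (y * 2) ≡ suc (z * 2 * 2)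
parent-leaf y with halves y
... | even z rewrite parent-even (z * 2) | even%2 z = z , inj₁ refl , +-comm (z * 2 * 2) 1
... | odd z  rewrite parent-even (suc (z * 2)) | odd%2 z = z , inj₂ refl , refl

L-parent : ∀ h j → L j ≡ h → L (parent j) ≡ suc h
L-parent zero j Lj with L-zero⇒even j Lj
... | q , refl with parent-leaf q
... | z , _ , pq rewrite pq | L-odd (z * 2) = cong suc (L-even z)
L-parent (suc h) j Lj with L-suc⇒odd j h Lj
... | j′ , refl , Lj′ rewrite parent-odd j′ | L-odd (parent j′) = cong suc (L-parent h j′ Lj′)

L-right-child : ∀ k j → L j ≡ suc k → L (j + 2 ^ k) ≡ k
L-right-child zero j Lj with L-suc⇒odd j 0 Lj
... | j′ , refl , Lj′ with L-zero⇒even j′ Lj′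
... | q , refl = trans (cong L (+-comm (suc (q * 2 * 2)) 1)) (L-even (suc (q * 2)))
L-right-child (suc k) j Lj with L-suc⇒odd j (suc k) Lj
... | j′ , refl , Lj′ = begin
  L (suc (j′ * 2) + 2 * 2 ^ k)  ≡⟨ cong L (odd-plus-even j′ (2 ^ k)) ⟩
  L (suc ((j′ + 2 ^ k) * 2))    ≡⟨ L-odd (j′ + 2 ^ k) ⟩
  suc (L (j′ + 2 ^ k))          ≡⟨ cong suc (L-right-child k j′ Lj′) ⟩
  suc k                         ∎
  where open ≡-Reasoning

window-end-odd : ∀ x h → L x ≡ h → ∃ λ t → x + 2 ^ h ≡ suc (t * 2)
window-end-odd x zero Lx with L-zero⇒even x Lx
... | q , refl = q , +-comm (q * 2) 1
window-end-odd x (suc h) Lx with L-suc⇒odd x h Lx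
... | x′ , refl , _ = x′ + 2 ^ h , odd-plus-even x′ (2 ^ h)

_⇝_ : ℕ → ℕ → Set
y ⇝ x = ∃ λ k → iterate k parent y ≡ x

iterate-shift : ∀ k (f : ℕ → ℕ) x → iterate k f (f x) ≡ iterate (suc k) f x
iterate-shift zero    f x = refl
iterate-shift (suc k) f x = cong f (iterate-shift k f x)

iterate-parent-odd : ∀ k m → iterate k parent (suc (m * 2)) ≡ suc (iterate k parent m * 2)
iterate-parent-odd zero    m = refl
iterate-parent-odd (suc k) m rewrite iterate-parent-odd k m = parent-odd (iterate k parent m)

⇝-step : ∀ {y x} → parent y ⇝ x → y ⇝ x
⇝-step {y} (k , eq) = suc k , trans (sym (iterate-shift k parent y)) eq

⇝-parent : ∀ {y x} → y ⇝ x → y ⇝ parent x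
⇝-parent (k , eq) = suc k , cong parent eq

⇝-odd : ∀ {y x} → y ⇝ x → suc (y * 2) ⇝ suc (x * 2)
⇝-odd {y} (k , eq) = k , trans (iterate-parent-odd k y) (cong (λ v → suc (v * 2)) eq)

-- The window of radius 2^h around x: for L x ≡ h it is x's subtree.
Window : ℕ → ℕ → ℕ → Set
Window h x y = y < x + 2 ^ h × x < y + 2 ^ h

window-odd : ∀ h x y → Window (suc h) (suc (x * 2)) (suc (y * 2)) → Window h x y
window-odd h x y (y< , x<) = halve y x y< , halve x y x<
  where
  halve : ∀ u v → suc (u * 2) < suc (v * 2) + 2 * 2 ^ h → u < v + 2 ^ h
  halve u v p = *-cancelʳ-< 2 u (v + 2 ^ h) (s≤s⁻¹ (subst (suc (u * 2) <_) (odd-plus-even v (2 ^ h)) p))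

window-even : ∀ h x y → Window (suc h) (suc (x * 2)) (y * 2) → y ≤ x + 2 ^ h × x < y + 2 ^ h
window-even h x y (y< , x<) =
  *-cancelʳ-≤ y (x + 2 ^ h) 2 (s≤s⁻¹ (subst (y * 2 <_) (odd-plus-even x (2 ^ h)) y<)) ,
  *-cancelʳ-< 2 x (y + 2 ^ h) (≤-trans (n≤1+n _) (subst (suc (x * 2) <_) (even-plus-even y (2 ^ h)) x<))

-- Rounding y down to the even number z * 2 keeps it in the window of x
-- because the window's right end x + 2^h is odd (window-end-odd).
window-round-even : ∀ h x y z t → y ≡ z * 2 ⊎ y ≡ suc (z * 2) → x + 2 ^ h ≡ suc (t * 2) →
  y ≤ x + 2 ^ h → x < y + 2 ^ h → Window h x (z * 2)
window-round-even h x y z t (inj₁ refl) end-odd y≤ x< =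
  ≤∧≢⇒< y≤ (λ eq → even≢odd′ z t (trans eq end-odd)) , x<
window-round-even h x y z t (inj₂ refl) end-odd y≤ x< =
  y≤ , ≤∧≢⇒< (s≤s⁻¹ x<) (λ eq → even≢odd′ (z + 2 ^ h) t (begin
    (z + 2 ^ h) * 2      ≡⟨ sym (even-plus-even z (2 ^ h)) ⟩
    z * 2 + 2 * 2 ^ h    ≡⟨ cong (λ r → z * 2 + (2 ^ h + r)) (+-identityʳ (2 ^ h)) ⟩
    z * 2 + (2 ^ h + 2 ^ h) ≡⟨ sym (+-assoc (z * 2) (2 ^ h) (2 ^ h)) ⟩
    z * 2 + 2 ^ h + 2 ^ h ≡⟨ cong (_+ 2 ^ h) (sym eq) ⟩
    x + 2 ^ h            ≡⟨ end-odd ⟩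
    suc (t * 2)          ∎))
  where open ≡-Reasoning

subtree-window : ∀ h x y → L x ≡ h → Window h x y → y ⇝ x
subtree-window zero x y _ (y< , x<) =
  0 , ≤-antisym (s≤s⁻¹ (subst (y <_) (+-comm x 1) y<)) (s≤s⁻¹ (subst (x <_) (+-comm y 1) x<))
subtree-window (suc h) x y Lx w with L-suc⇒odd x h Lx
... | x′ , refl , Lx′ with halves y
... | odd y′ = ⇝-odd (subtree-window h x′ y′ Lx′ (window-odd h x′ y′ w))
... | even y′ with parent-leaf y′ | window-end-odd x′ h Lx′ | window-even h x′ y′ w
... | z , rounding , py | t , end-odd | y′≤ , x′< =
  ⇝-step (subst (_⇝ suc (x′ * 2)) (sym py)
    (⇝-odd (subtree-window h x′ (z * 2) Lx′ (window-round-even h x′ y′ z t rounding end-odd y′≤ x′<))))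

window-end-in-tree : ∀ K x → suc x < 2 ^ K → x + 2 ^ L x < 2 ^ K
window-end-in-tree zero x (s≤s ())
window-end-in-tree (suc K) x x<top with halves x
... | even q rewrite L-even q | +-comm (q * 2) 1 = x<top
... | odd q rewrite L-odd q | odd-plus-even q (2 ^ L q) | *-comm 2 (2 ^ K) =
  *-monoˡ-≤ 2 (window-end-in-tree K q (*-cancelʳ-< 2 (suc q) (2 ^ K) x<top))

L-top : ∀ K x → suc x ≡ 2 ^ K → L x ≡ K
L-top zero zero refl = refl
L-top (suc K) x top with halves x
... | even q = ⊥-elim (even≢odd′ (2 ^ K) q (sym (trans top (*-comm 2 (2 ^ K)))))
... | odd q rewrite L-odd q =
  cong suc (L-top K q (*-cancelʳ-≡ (suc q) (2 ^ K) 2 (trans top (*-comm 2 (2 ^ K)))))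

root-unique : ∀ h x → L x ≡ h → suc x < 2 ^ suc h → suc x ≡ 2 ^ h
root-unique zero zero _ _ = refl
root-unique zero (suc x) _ (s≤s (s≤s ()))
root-unique (suc h) x Lx x<top with L-suc⇒odd x h Lx
... | x′ , refl , Lx′ =
  trans (cong (_* 2) (root-unique h x′ Lx′ (*-cancelʳ-< 2 (suc x′) (2 ^ suc h) x<top′)))
        (*-comm (2 ^ h) 2)
  where
  x<top′ : suc (suc x′ * 2) ≤ 2 ^ suc h * 2
  x<top′ = subst (suc (suc x′ * 2) ≤_) (*-comm 2 (2 ^ suc h)) x<top

parent-to-top⇒root : ∀ m j → suc j < 2 ^ suc m → suc (parent j) ≡ 2 ^ suc m → suc j ≡ 2 ^ m
parent-to-top⇒root m j j<top top = root-unique m j Lj≡m j<top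
  where
  Lj≡m : L j ≡ m
  Lj≡m = suc-injective (trans (sym (L-parent (L j) j refl)) (L-top (suc m) (parent j) top))

below-top : ∀ N → N < 2 ^ K N
below-top N with 2 ^ K N ≤? N
... | yes top≤N = ⊥-elim (1+n≰n (subst (_≤ M N) (⌊log₂[2^n]⌋≡n (K N)) (⌊log₂⌋-mono-≤ top≤N)))
... | no top≰N = ≰⇒> top≰N

on-path : ∀ N x → (N ∸ 1) ⇝ x → suc x < 2 ^ K N → OnPath N x
on-path N x (k , eq) x<top = k , eq , ∸-monoˡ-≤ 2 x<top

left-edge-below : ∀ N j e → lArr N j ≡ just e → e ≤ j
left-edge-below N j e eq with L j
... | suc k with eq
... | refl = m∸n≤m j (2 ^ k)

up-edge-shape : ∀ N j e → pArr N j ≡ just e → ¬ j ≡ 2 ^ M N ∸ 1 × e ≡ parent j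
up-edge-shape N j e eq with j ≡ᵇ (2 ^ M N ∸ 1) in is-root
... | false = (λ j≡root → subst T is-root (≡⇒≡ᵇ _ _ j≡root)) , sym (just-injective eq)

right-edge-shape : ∀ N j e → rArr N j ≡ just e → ∃ λ k → L j ≡ suc k × e ≡ j + 2 ^ k
right-edge-shape N j e eq with L j
... | suc k with eq
... | refl = k , refl , refl

up-edge-on-path : ∀ n j → j ≤ n → n < j + 2 ^ L j → parent j ≡ j + 2 ^ L j →
  ¬ j ≡ 2 ^ M (suc n) ∸ 1 → OnPath (suc n) j × OnPath (suc n) (parent j)
up-edge-on-path n j j≤n n<e goes-up not-root =
  on-path (suc n) j n⇝j j<top , on-path (suc n) (parent j) (⇝-parent n⇝j) e<top
  where
  n⇝j : n ⇝ j
  n⇝j = subtree-window (L j) j n refl (n<e , ≤-<-trans j≤n (m<m+n n (m^n>0 2 (L j))))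
  j<top : suc j < 2 ^ K (suc n)
  j<top = ≤-<-trans (s≤s j≤n) (below-top (suc n))
  e<top : suc (parent j) < 2 ^ K (suc n)
  e<top with m≤n⇒m<n∨m≡n (subst (_< 2 ^ K (suc n)) (sym goes-up) (window-end-in-tree (K (suc n)) j j<top))
  ... | inj₁ e<top = e<top
  ... | inj₂ e≡top = ⊥-elim (not-root (cong (_∸ 1) (parent-to-top⇒root (M (suc n)) j j<top e≡top)))

right-edge-on-path : ∀ n j k → j < n → L j ≡ suc k → n < j + 2 ^ k →
  OnPath (suc n) j × OnPath (suc n) (j + 2 ^ k)
right-edge-on-path n j k j<n Lj n<e =
  on-path (suc n) j n⇝j j<top , on-path (suc n) (j + 2 ^ k) n⇝e e<top
  where
  n⇝j : n ⇝ j
  n⇝j = subtree-window (suc k) j n Lj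
    (<-≤-trans n<e (+-monoʳ-≤ j (^-monoʳ-≤ 2 (n≤1+n k))) , <-≤-trans j<n (m≤m+n n _))
  n⇝e : n ⇝ (j + 2 ^ k)
  n⇝e = subtree-window k (j + 2 ^ k) n (L-right-child k j Lj)
    (<-≤-trans n<e (m≤m+n _ _) , +-monoˡ-< (2 ^ k) j<n)
  j<top : suc j < 2 ^ K (suc n)
  j<top = <-trans (s≤s j<n) (below-top (suc n))
  e+2^k≡window-end : j + 2 ^ k + 2 ^ k ≡ j + 2 ^ L j
  e+2^k≡window-end = begin
    j + 2 ^ k + 2 ^ k        ≡⟨ +-assoc j (2 ^ k) (2 ^ k) ⟩
    j + (2 ^ k + 2 ^ k)      ≡⟨ cong (λ r → j + (2 ^ k + r)) (sym (+-identityʳ (2 ^ k))) ⟩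
    j + 2 ^ suc k            ≡⟨ cong (λ l → j + 2 ^ l) (sym Lj) ⟩
    j + 2 ^ L j              ∎
    where open ≡-Reasoning
  e<top : suc (j + 2 ^ k) < 2 ^ K (suc n)
  e<top = ≤-<-trans (subst (suc (j + 2 ^ k) ≤_) e+2^k≡window-end
                       (subst (_≤ j + 2 ^ k + 2 ^ k) (+-comm (j + 2 ^ k) 1)
                              (+-monoʳ-≤ (j + 2 ^ k) (m^n>0 2 k))))
                    (window-end-in-tree (K (suc n)) j j<top)

lemma1 : (N : ℕ) → 1 ≤ N → (j : ℕ) → j < N → (d : Dir) → (e : ℕ) →
    entry d N j ≡ just e → N ≤ e → ¬ (d ≡ right × j ≡ N ∸ 1) →
    OnPath N j × OnPath N e
lemma1 (suc n) _ j j<N left e eq N≤e _ =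
  ⊥-elim (<⇒≱ (<-≤-trans j<N N≤e) (left-edge-below (suc n) j e eq))
lemma1 (suc n) _ j j<N up e eq N≤e _ with up-edge-shape (suc n) j e eq | parent-up-or-down j
... | not-root , refl | inj₁ goes-up =
  up-edge-on-path n j (s≤s⁻¹ j<N) (subst (n <_) goes-up N≤e) goes-up not-root
... | _ , refl | inj₂ goes-down =
  ⊥-elim (<⇒≱ (<-≤-trans j<N N≤e) (subst (_≤ j) (sym goes-down) (m∸n≤m j (2 ^ L j))))
lemma1 (suc n) _ j j<N right e eq N≤e not-last with right-edge-shape (suc n) j e eq
... | k , Lj , refl =
  right-edge-on-path n j k (≤∧≢⇒< (s≤s⁻¹ j<N) (λ j≡n → not-last (refl , j≡n))) Lj N≤e
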